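{- For any integer $d\ge0$, root ideal $\Psi\subset\Delta^+_\ell$ and $\gamma\in\mathbb Z^\ell$, $$e_d^\perp\,H(\Psi;\gamma)=\sum_{S\subset[\ell],\,|S|=d}H(\Psi;\gamma-\epsilon_S).$$
   Context: $\Lambda$ is the ring of symmetric functions over $\mathbb Q(t)$; $e_d$ elementary symmetric function and $e_d^\perp$ the adjoint of multiplication by $e_d$ for the Hall inner product. $[\ell]=\{1,\dots,\ell\}$, $\epsilon_S=\sum_{i\in S}\epsilon_i$ with $\epsilon_i$ standard basis vectors of $\mathbb Z^\ell$. For $\gamma\in\mathbb Z^\ell$, $s_\gamma=\det(h_{\gamma_i+j-i})_{1\le i,j\le\ell}$ ($h_0=1$, $h_d=0$ for $d<0$). $\Delta^+_\ell=\{(i,j):1\le i<j\le\ell\}$ with order $(a,b)\le(c,d)$ iff $a\ge c$ and $b\le d$; a root ideal is an upper order ideal. $H(\Psi;\gamma)$ is obtained by expanding $\prod_{(i,j)\in\Psi}(1-tz_i/z_j)^{ -1}z^\gamma$ as a power series in $t$ and applying coefficientwise the linear map $z^\beta\mapsto s_\beta$. -}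

module Defs where

open import Data.Bool using (Bool; true; false; if_then_else_; _∧_)
open import Data.Nat as ℕ using (ℕ; zero; suc; _∸_; _⊓_; _≡ᵇ_)
open import Data.Integer as ℤ using (ℤ; +_; -[1+_])
open import Data.Fin as Fin using (Fin; toℕ; punchIn; _≟_)
open import Data.List as List using (List; []; _∷_; _++_; map; concatMap; upTo; allFin; foldr)
open import Data.Nat.ListAction using (sum)
open import Data.Bool.ListAction using (any; all)
open import Data.Product using (_×_; _,_; proj₁; proj₂)
open import Relation.Nullary.Decidable using (⌊_⌋)
open import Relation.Binary.PropositionalEquality using (_≡_)

-- An element of Λ is represented as a finite ℤ-linear combination of
-- formal products of generators; the generators are h_n and e_n.
-- Its actual value as a symmetric function is determined by its
-- monomial coefficients  [x^α] f  (computed by `mcoeff` below),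
-- using  h_n = Σ_{|α|=n} x^α  and  e_n = Σ_{α ∈ {0,1}^*, |α|=n} x^α.

data Gen : Set where
  h : ℕ → Gen
  e : ℕ → Gen

Poly : Set → Set
Poly G = List (ℤ × List G)

-- h-polynomials (elements of Λ written in the h_λ's) and general elements
HPoly : Set
HPoly = Poly ℕ

Λ : Set
Λ = Poly Gen

module _ {G : Set} where
  0P : Poly G
  0P = []

  1P : Poly G
  1P = (ℤ.1ℤ , []) ∷ []

  _+P_ : Poly G → Poly G → Poly G
  _+P_ = _++_

  _*P_ : Poly G → Poly G → Poly G
  f *P g = concatMap (λ t → map (λ u → (proj₁ t ℤ.* proj₁ u , proj₂ t ++ proj₂ u)) g) f

  _·P_ : ℤ → Poly G → Poly G
  c ·P f = map (λ t → (c ℤ.* proj₁ t , proj₂ t)) f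

  sumP : List (Poly G) → Poly G
  sumP = foldr _+P_ 0P

embed : HPoly → Λ
embed = map (λ t → (proj₁ t , map h (proj₂ t)))

-- h_n for n ∈ ℤ, with h_n = 0 for n < 0 (h_0 = 1 via its expansion)
hℤ : ℤ → HPoly
hℤ (+ n)    = (ℤ.1ℤ , n ∷ []) ∷ []
hℤ -[1+ n ] = []

eΛ : ℕ → Λ
eΛ d = (ℤ.1ℤ , e d ∷ []) ∷ []

-- rems c a α : list of all α - β where β ≤ α componentwise,
-- |β| = a and every entry of β is ≤ c.
rems : ℕ → ℕ → List ℕ → List (List ℕ)
rems c a []       = if a ≡ᵇ 0 then [] ∷ [] else []
rems c a (x ∷ xs) =
  concatMap (λ b → map ((x ∸ b) ∷_) (rems c (a ∸ b) xs)) (upTo (suc (c ⊓ (a ⊓ x))))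

genDeg : Gen → ℕ
genDeg (h n) = n
genDeg (e n) = n

genCap : Gen → ℕ
genCap (h n) = n
genCap (e n) = 1

monoCoeff : List Gen → List ℕ → ℕ
monoCoeff []       α = if all (_≡ᵇ 0) α then 1 else 0
monoCoeff (g ∷ gs) α = sum (map (monoCoeff gs) (rems (genCap g) (genDeg g) α))

mcoeff : Λ → List ℕ → ℤ
mcoeff f α = foldr ℤ._+_ ℤ.0ℤ (map (λ t → proj₁ t ℤ.* (+ monoCoeff (proj₂ t) α)) f)

-- Hall inner product, defined by ⟨h_λ, m_μ⟩ = δ_{λμ}:
-- ⟨ Σ c_λ h_λ , g ⟩ = Σ c_λ [m_λ] g = Σ c_λ [x^λ] g.
⟨_,_⟩ : HPoly → Λ → ℤ
⟨ f , g ⟩ = foldr ℤ._+_ ℤ.0ℤ (map (λ t → proj₁ t ℤ.* mcoeff g (proj₂ t)) f)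

det : (n : ℕ) → (Fin n → Fin n → HPoly) → HPoly
det zero    M = 1P
det (suc n) M =
  sumP (map (λ j → ((ℤ.-1ℤ) ℤ.^ toℕ j) ·P
                   (M Fin.zero j *P det n (λ i k → M (Fin.suc i) (punchIn j k))))
            (allFin (suc n)))

s : (ℓ : ℕ) → (Fin ℓ → ℤ) → HPoly
s ℓ γ = det ℓ (λ i j → hℤ ((γ i ℤ.+ + toℕ j) ℤ.- + toℕ i))

record IsRootIdeal {ℓ : ℕ} (Ψ : Fin ℓ → Fin ℓ → Bool) : Set where
  field
    positive : ∀ i j → Ψ i j ≡ true → i Fin.< j
    upper    : ∀ a b c d → Ψ a b ≡ true → c Fin.≤ a → b Fin.≤ d → Ψ c d ≡ true

roots : {ℓ : ℕ} → (Fin ℓ → Fin ℓ → Bool) → List (Fin ℓ × Fin ℓ)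
roots {ℓ} Ψ = concatMap (λ i → concatMap (λ j → if Ψ i j then (i , j) ∷ [] else []) (allFin ℓ)) (allFin ℓ)

comps : ℕ → ℕ → List (List ℕ)
comps zero    k = if k ≡ᵇ 0 then [] ∷ [] else []
comps (suc r) k = concatMap (λ m → map (m ∷_) (comps r (k ∸ m))) (upTo (suc k))

-- z^γ ↦ z^γ · Π (z_i/z_j)^{m_ij}
shift : {ℓ : ℕ} → (Fin ℓ → ℤ) → List (Fin ℓ × Fin ℓ) → List ℕ → (Fin ℓ → ℤ)
shift γ (r ∷ rs) (m ∷ ms) p =
  (shift γ rs ms p ℤ.+ (if ⌊ p ≟ proj₁ r ⌋ then + m else ℤ.0ℤ))
                   ℤ.- (if ⌊ p ≟ proj₂ r ⌋ then + m else ℤ.0ℤ)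
shift γ _ _ p = γ p

-- coefficient of t^k in H(Ψ;γ):
-- Σ over (m_r)_{r∈Ψ}, Σ m_r = k, of s_{γ + Σ m_(i,j) (ε_i - ε_j)}
Hcoeff : (ℓ : ℕ) → (Fin ℓ → Fin ℓ → Bool) → (Fin ℓ → ℤ) → ℕ → HPoly
Hcoeff ℓ Ψ γ k =
  sumP (map (λ ms → s ℓ (shift γ (roots Ψ) ms)) (comps (List.length (roots Ψ)) k))

subsetsOfSize : (n d : ℕ) → List (List (Fin n))
subsetsOfSize n       zero    = [] ∷ []
subsetsOfSize zero    (suc d) = []
subsetsOfSize (suc n) (suc d) =
  map (λ S → Fin.zero ∷ map Fin.suc S) (subsetsOfSize n d)
  ++ map (map Fin.suc) (subsetsOfSize n (suc d))

minusε : {ℓ : ℕ} → (Fin ℓ → ℤ) → List (Fin ℓ) → (Fin ℓ → ℤ)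
minusε γ S p = γ p ℤ.- (if any (λ q → ⌊ p ≟ q ⌋) S then ℤ.1ℤ else ℤ.0ℤ)

-- For each Schur term, e_d^⊥ s_β = Σ_{|S|=d} s_{β-ε_S}: expanding the Jacobi–Trudi
-- determinant along its first row, this reduces by induction on ℓ to the rule
-- e_d^⊥ (h_a F) = h_a (e_d^⊥ F) + h_{a-1} (e_{d-1}^⊥ F), which on the dual side is the
-- recursion of the monomial coefficients of e_d g in the first exponent. Since the
-- raising operators z_i/z_j commute with z^β ↦ z^{β-ε_S}, the identity passes to H(Ψ;γ)
-- term by term.
module Submission where

open import Defs
open import Data.Nat using (ℕ)
open import Data.Integer using (ℤ)
open import Data.Bool using (Bool)
open import Data.Fin using (Fin)
open import Data.List using (map)
open import Relation.Binary.PropositionalEquality using (_≡_)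

open import Data.Bool using (if_then_else_)
open import Data.Nat using (zero; suc)
open import Data.Nat.ListAction using (sum)
open import Data.Integer using (+_; -[1+_]; 0ℤ; 1ℤ; -1ℤ; _+_; _-_; _*_; _^_)
import Data.Integer.Properties as ℤ
open import Data.Integer.Solver using (module +-*-Solver)
open import Algebra.Properties.CommutativeSemigroup ℤ.+-commutativeSemigroup using (interchange)
open import Data.Fin using (toℕ; punchIn; _≟_) renaming (zero to fzero; suc to fsuc)
open import Data.List using (List; []; _∷_; _++_; foldr; allFin; length)
import Data.List.Properties as List
open import Data.Bool.ListAction using (any)
open import Data.Product using (_×_; proj₁; proj₂)
open import Function using (_∘_)
open import Relation.Nullary.Decidable using (⌊_⌋; yes; no)
open import Relation.Binary.PropositionalEquality
  using (_≗_; refl; sym; trans; cong; cong₂; module ≡-Reasoning)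

private variable
  A B : Set

∑ : List A → (A → ℤ) → ℤ
∑ xs f = foldr _+_ 0ℤ (map f xs)

infix 5 ∑
syntax ∑ xs (λ x → t) = ∑[ x ∈ xs ] t

∑-++ : (xs ys : List A) (f : A → ℤ) → ∑ (xs ++ ys) f ≡ ∑ xs f + ∑ ys f
∑-++ []       ys f = sym (ℤ.+-identityˡ _)
∑-++ (x ∷ xs) ys f = trans (cong (_+_ (f x)) (∑-++ xs ys f)) (sym (ℤ.+-assoc (f x) _ _))

∑-cong : (xs : List A) {f g : A → ℤ} → f ≗ g → ∑ xs f ≡ ∑ xs g
∑-cong xs f≗g = cong (foldr _+_ 0ℤ) (List.map-cong f≗g xs)

∑-map : (F : A → B) (xs : List A) (f : B → ℤ) → ∑ (map F xs) f ≡ ∑ xs (f ∘ F)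
∑-map F xs f = cong (foldr _+_ 0ℤ) (sym (List.map-∘ xs))

∑-zero : (xs : List A) → ∑[ _ ∈ xs ] 0ℤ ≡ 0ℤ
∑-zero []       = refl
∑-zero (x ∷ xs) = trans (ℤ.+-identityˡ _) (∑-zero xs)

∑-+ : (xs : List A) (f g : A → ℤ) → ∑[ x ∈ xs ] (f x + g x) ≡ ∑ xs f + ∑ xs g
∑-+ []       f g = refl
∑-+ (x ∷ xs) f g =
  trans (cong (_+_ (f x + g x)) (∑-+ xs f g)) (interchange (f x) (g x) (∑ xs f) (∑ xs g))

*-distribˡ-∑ : (c : ℤ) (xs : List A) (f : A → ℤ) → c * ∑ xs f ≡ ∑[ x ∈ xs ] (c * f x)
*-distribˡ-∑ c []       f = ℤ.*-zeroʳ c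
*-distribˡ-∑ c (x ∷ xs) f =
  trans (ℤ.*-distribˡ-+ c (f x) _) (cong (_+_ (c * f x)) (*-distribˡ-∑ c xs f))

∑-comm : (xs : List A) (ys : List B) (f : A → B → ℤ) →
  ∑[ x ∈ xs ] ∑ ys (f x) ≡ ∑[ y ∈ ys ] ∑[ x ∈ xs ] f x y
∑-comm []       ys f = sym (∑-zero ys)
∑-comm (x ∷ xs) ys f =
  trans (cong (_+_ (∑ ys (f x))) (∑-comm xs ys f)) (sym (∑-+ ys (f x) _))

∑-comm-*ˡ : (xs : List A) (ys : List B) (c : B → ℤ) (f : A → B → ℤ) →
  ∑[ x ∈ xs ] ∑[ y ∈ ys ] (c y * f x y) ≡ ∑[ y ∈ ys ] (c y * (∑[ x ∈ xs ] f x y))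
∑-comm-*ˡ xs ys c f =
  trans (∑-comm xs ys (λ x y → c y * f x y))
        (∑-cong ys (λ y → sym (*-distribˡ-∑ (c y) xs (λ x → f x y))))

pos-sum : (f : A → ℕ) (xs : List A) → + sum (map f xs) ≡ ∑[ x ∈ xs ] + f x
pos-sum f []       = refl
pos-sum f (x ∷ xs) = trans (ℤ.pos-+ (f x) _) (cong (_+_ (+ f x)) (pos-sum f xs))

-- h_λ ↦ φ λ for an arbitrary φ, so that the induction can fix leading exponents;
-- the Hall product ⟨ f , g ⟩ is  pair (mcoeff g) f.
pair : (List ℕ → ℤ) → HPoly → ℤ
pair φ f = ∑[ t ∈ f ] (proj₁ t * φ (proj₂ t))

pair-cong : {φ ψ : List ℕ → ℤ} (f : HPoly) → φ ≗ ψ → pair φ f ≡ pair ψ f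
pair-cong f φ≗ψ = ∑-cong f (λ t → cong (proj₁ t *_) (φ≗ψ (proj₂ t)))

pair-+ : (φ ψ : List ℕ → ℤ) (f : HPoly) → pair (λ α → φ α + ψ α) f ≡ pair φ f + pair ψ f
pair-+ φ ψ f = trans (∑-cong f (λ t → ℤ.*-distribˡ-+ (proj₁ t) _ _)) (∑-+ f _ _)

pair-·P : (φ : List ℕ → ℤ) (c : ℤ) (f : HPoly) → pair φ (c ·P f) ≡ c * pair φ f
pair-·P φ c f =
  trans (∑-map _ f _)
        (trans (∑-cong f (λ t → ℤ.*-assoc c (proj₁ t) _)) (sym (*-distribˡ-∑ c f _)))

pair-sumP-map : (φ : List ℕ → ℤ) (F : A → HPoly) (xs : List A) →
  pair φ (sumP (map F xs)) ≡ ∑[ x ∈ xs ] pair φ (F x)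
pair-sumP-map φ F []       = refl
pair-sumP-map φ F (x ∷ xs) =
  trans (∑-++ (F x) _ _) (cong (_+_ (pair φ (F x))) (pair-sumP-map φ F xs))

pairH : ℤ → (List ℕ → ℤ) → HPoly → ℤ
pairH (+ n)    φ D = pair (φ ∘ (n ∷_)) D
pairH -[1+ n ] φ D = 0ℤ

pair-hℤ*P : (φ : List ℕ → ℤ) (a : ℤ) (D : HPoly) → pair φ (hℤ a *P D) ≡ pairH a φ D
pair-hℤ*P φ -[1+ n ] D = refl
pair-hℤ*P φ (+ n)    D =
  trans (∑-++ (map _ D) [] _)
        (trans (ℤ.+-identityʳ _)
               (trans (∑-map _ D _)
                      (∑-cong D (λ t → cong (_* φ (n ∷ proj₂ t)) (ℤ.*-identityˡ (proj₁ t))))))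

eSkew : ℕ → (List ℕ → ℤ) → List ℕ → ℤ
eSkew d φ α = ∑ (rems 1 d α) φ

mcoeff-eΛ*P : (d : ℕ) (g : Λ) → mcoeff (eΛ d *P g) ≗ eSkew d (mcoeff g)
mcoeff-eΛ*P d g α = begin
  mcoeff (eΛ d *P g) α
    ≡⟨ trans (∑-++ (map _ g) [] _) (trans (ℤ.+-identityʳ _) (∑-map _ g _)) ⟩
  ∑[ u ∈ g ] (1ℤ * proj₁ u * + monoCoeff (e d ∷ proj₂ u) α)
    ≡⟨ ∑-cong g (λ u → cong₂ _*_ (ℤ.*-identityˡ (proj₁ u))
                                   (pos-sum (monoCoeff (proj₂ u)) (rems 1 d α))) ⟩
  ∑[ u ∈ g ] (proj₁ u * (∑[ β ∈ rems 1 d α ] + monoCoeff (proj₂ u) β))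
    ≡⟨ ∑-cong g (λ u → *-distribˡ-∑ (proj₁ u) (rems 1 d α) _) ⟩
  ∑[ u ∈ g ] ∑[ β ∈ rems 1 d α ] (proj₁ u * + monoCoeff (proj₂ u) β)
    ≡⟨ ∑-comm g (rems 1 d α) _ ⟩
  eSkew d (mcoeff g) α
    ∎
  where open ≡-Reasoning

rems-zero : (α : List ℕ) → rems 1 0 α ≡ α ∷ []
rems-zero []      = refl
rems-zero (x ∷ α) = cong (λ βs → map (x ∷_) βs ++ []) (rems-zero α)

eSkew-zero : (φ : List ℕ → ℤ) → eSkew 0 φ ≗ φ
eSkew-zero φ α = trans (cong (λ βs → ∑ βs φ) (rems-zero α)) (ℤ.+-identityʳ (φ α))

eSkew-0∷ : (d : ℕ) (φ : List ℕ → ℤ) (α : List ℕ) →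
  eSkew (suc d) φ (0 ∷ α) ≡ eSkew (suc d) (φ ∘ (0 ∷_)) α
eSkew-0∷ d φ α =
  trans (∑-++ (map (0 ∷_) (rems 1 (suc d) α)) [] φ)
        (trans (ℤ.+-identityʳ _) (∑-map (0 ∷_) (rems 1 (suc d) α) φ))

eSkew-suc∷ : (d n : ℕ) (φ : List ℕ → ℤ) (α : List ℕ) →
  eSkew (suc d) φ (suc n ∷ α) ≡ eSkew (suc d) (φ ∘ (suc n ∷_)) α + eSkew d (φ ∘ (n ∷_)) α
eSkew-suc∷ d n φ α =
  trans (∑-++ (map (suc n ∷_) (rems 1 (suc d) α)) _ φ)
        (cong₂ _+_ (∑-map (suc n ∷_) (rems 1 (suc d) α) φ)
                   (trans (∑-++ (map (n ∷_) (rems 1 d α)) [] φ)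
                          (trans (ℤ.+-identityʳ _) (∑-map (n ∷_) (rems 1 d α) φ))))

sign : {n : ℕ} → Fin n → ℤ
sign j = -1ℤ ^ toℕ j

det-cong : (n : ℕ) {M N : Fin n → Fin n → HPoly} → (∀ i j → M i j ≡ N i j) → det n M ≡ det n N
det-cong zero    M≡N = refl
det-cong (suc n) M≡N = cong sumP (List.map-cong (λ j →
  cong (sign j ·P_) (cong₂ _*P_ (M≡N fzero j)
                               (det-cong n (λ i k → M≡N (fsuc i) (punchIn j k))))) (allFin (suc n)))

hDet : {n : ℕ} → (Fin n → Fin n → ℤ) → HPoly
hDet {n} A = det n (λ i j → hℤ (A i j))

hDet-cong : {n : ℕ} {A B : Fin n → Fin n → ℤ} → (∀ i j → A i j ≡ B i j) → hDet A ≡ hDet B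
hDet-cong {n} A≡B = det-cong n (λ i j → cong hℤ (A≡B i j))

minor : {n : ℕ} → (Fin (suc n) → Fin (suc n) → ℤ) → Fin (suc n) → Fin n → Fin n → ℤ
minor A j i k = A (fsuc i) (punchIn j k)

pair-hDet-suc : (φ : List ℕ → ℤ) {n : ℕ} (A : Fin (suc n) → Fin (suc n) → ℤ) →
  pair φ (hDet A) ≡ ∑[ j ∈ allFin (suc n) ] (sign j * pairH (A fzero j) φ (hDet (minor A j)))
pair-hDet-suc φ {n} A =
  trans (pair-sumP-map φ (λ j → sign j ·P (hℤ (A fzero j) *P hDet (minor A j))) (allFin (suc n)))
        (∑-cong (allFin (suc n)) (λ j →
          trans (pair-·P φ (sign j) (hℤ (A fzero j) *P hDet (minor A j)))
                (cong (sign j *_) (pair-hℤ*P φ (A fzero j) (hDet (minor A j))))))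

indicator : {n : ℕ} → List (Fin n) → Fin n → ℤ
indicator S p = if any (λ q → ⌊ p ≟ q ⌋) S then 1ℤ else 0ℤ

lowerRows : {n : ℕ} → (Fin n → Fin n → ℤ) → List (Fin n) → Fin n → Fin n → ℤ
lowerRows A S i j = A i j - indicator S i

indicator-fsuc : {n : ℕ} (S : List (Fin n)) (i : Fin n) → indicator (map fsuc S) (fsuc i) ≡ indicator S i
indicator-fsuc []      i = refl
indicator-fsuc (q ∷ S) i with i ≟ q
... | yes _ = refl
... | no  _ = indicator-fsuc S i

indicator-fzero : {n : ℕ} (S : List (Fin n)) → indicator (map fsuc S) fzero ≡ 0ℤ
indicator-fzero []      = refl
indicator-fzero (q ∷ S) = indicator-fzero S

pair-hDet-lowerRows : (φ : List ℕ → ℤ) {m : ℕ} (A : Fin (suc m) → Fin (suc m) → ℤ)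
  (S′ : List (Fin (suc m))) (S : List (Fin m)) → (∀ i → indicator S′ (fsuc i) ≡ indicator S i) →
  pair φ (hDet (lowerRows A S′))
    ≡ ∑[ j ∈ allFin (suc m) ]
        (sign j * pairH (A fzero j - indicator S′ fzero) φ (hDet (lowerRows (minor A j) S)))
pair-hDet-lowerRows φ {m} A S′ S S′≡S =
  trans (pair-hDet-suc φ (lowerRows A S′))
        (∑-cong (allFin (suc m)) (λ j → cong (λ D → sign j * pairH (A fzero j - indicator S′ fzero) φ D)
          (hDet-cong (λ i k → cong (A (fsuc i) (punchIn j k) -_) (S′≡S i)))))

SkewIdentity : ℕ → ℕ → Set
SkewIdentity n d = (A : Fin n → Fin n → ℤ) (φ : List ℕ → ℤ) →
  ∑[ S ∈ subsetsOfSize n d ] pair φ (hDet (lowerRows A S)) ≡ pair (eSkew d φ) (hDet A)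

skewIdentity-zero : (n : ℕ) → SkewIdentity n 0
skewIdentity-zero n A φ = begin
  pair φ (hDet (lowerRows A [])) + 0ℤ ≡⟨ ℤ.+-identityʳ _ ⟩
  pair φ (hDet (lowerRows A []))      ≡⟨ cong (pair φ) (hDet-cong (λ i j → ℤ.+-identityʳ (A i j))) ⟩
  pair φ (hDet A)                     ≡⟨ pair-cong (hDet A) (sym ∘ eSkew-zero φ) ⟩
  pair (eSkew 0 φ) (hDet A)           ∎
  where open ≡-Reasoning

pairH-eSkew : {m : ℕ} (d : ℕ) → (∀ d → SkewIdentity m d) →
  (a : ℤ) (B : Fin m → Fin m → ℤ) (φ : List ℕ → ℤ) →
  (∑[ S ∈ subsetsOfSize m d ] pairH (a - 1ℤ) φ (hDet (lowerRows B S)))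
    + (∑[ S ∈ subsetsOfSize m (suc d) ] pairH a φ (hDet (lowerRows B S)))
    ≡ pairH a (eSkew (suc d) φ) (hDet B)
pairH-eSkew {m} d skew -[1+ n ] B φ =
  cong₂ _+_ (∑-zero (subsetsOfSize m d)) (∑-zero (subsetsOfSize m (suc d)))
pairH-eSkew {m} d skew (+ zero) B φ = begin
  (∑[ S ∈ subsetsOfSize m d ] 0ℤ)
    + (∑[ S ∈ subsetsOfSize m (suc d) ] pair (φ ∘ (0 ∷_)) (hDet (lowerRows B S)))
    ≡⟨ trans (cong (_+ lowered) (∑-zero (subsetsOfSize m d))) (ℤ.+-identityˡ lowered) ⟩
  ∑[ S ∈ subsetsOfSize m (suc d) ] pair (φ ∘ (0 ∷_)) (hDet (lowerRows B S))
    ≡⟨ skew (suc d) B (φ ∘ (0 ∷_)) ⟩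
  pair (eSkew (suc d) (φ ∘ (0 ∷_))) (hDet B)
    ≡⟨ pair-cong (hDet B) (sym ∘ eSkew-0∷ d φ) ⟩
  pair (eSkew (suc d) φ ∘ (0 ∷_)) (hDet B)
    ∎
  where
  open ≡-Reasoning
  lowered : ℤ
  lowered = ∑[ S ∈ subsetsOfSize m (suc d) ] pair (φ ∘ (0 ∷_)) (hDet (lowerRows B S))
pairH-eSkew {m} d skew (+ suc n) B φ = begin
  (∑[ S ∈ subsetsOfSize m d ] pair (φ ∘ (n ∷_)) (hDet (lowerRows B S)))
    + (∑[ S ∈ subsetsOfSize m (suc d) ] pair (φ ∘ (suc n ∷_)) (hDet (lowerRows B S)))
    ≡⟨ cong₂ _+_ (skew d B (φ ∘ (n ∷_))) (skew (suc d) B (φ ∘ (suc n ∷_))) ⟩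
  pair (eSkew d (φ ∘ (n ∷_))) (hDet B) + pair (eSkew (suc d) (φ ∘ (suc n ∷_))) (hDet B)
    ≡⟨ ℤ.+-comm (pair (eSkew d (φ ∘ (n ∷_))) (hDet B)) (pair (eSkew (suc d) (φ ∘ (suc n ∷_))) (hDet B)) ⟩
  pair (eSkew (suc d) (φ ∘ (suc n ∷_))) (hDet B) + pair (eSkew d (φ ∘ (n ∷_))) (hDet B)
    ≡⟨ sym (pair-+ (eSkew (suc d) (φ ∘ (suc n ∷_))) (eSkew d (φ ∘ (n ∷_))) (hDet B)) ⟩
  pair (λ α → eSkew (suc d) (φ ∘ (suc n ∷_)) α + eSkew d (φ ∘ (n ∷_)) α) (hDet B)
    ≡⟨ pair-cong (hDet B) (sym ∘ eSkew-suc∷ d n φ) ⟩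
  pair (eSkew (suc d) φ ∘ (suc n ∷_)) (hDet B)
    ∎
  where open ≡-Reasoning

skewIdentity : (n d : ℕ) → SkewIdentity n d
skewIdentity n       zero    = skewIdentity-zero n
skewIdentity zero    (suc d) A φ = refl
skewIdentity (suc m) (suc d) A φ = begin
  ∑[ S ∈ map (λ S → fzero ∷ map fsuc S) below ++ map (map fsuc) above ] lowered S
    ≡⟨ ∑-++ (map (λ S → fzero ∷ map fsuc S) below) (map (map fsuc) above) lowered ⟩
  ∑ (map (λ S → fzero ∷ map fsuc S) below) lowered + ∑ (map (map fsuc) above) lowered
    ≡⟨ cong₂ _+_ (trans (∑-map _ below lowered) (∑-cong below expand-with-0))
                 (trans (∑-map _ above lowered) (∑-cong above expand-without-0)) ⟩
  (∑[ S ∈ below ] ∑[ j ∈ cols ] (sign j * term (A fzero j - 1ℤ) j S))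
    + (∑[ S ∈ above ] ∑[ j ∈ cols ] (sign j * term (A fzero j) j S))
    ≡⟨ cong₂ _+_ (∑-comm-*ˡ below cols sign (λ S j → term (A fzero j - 1ℤ) j S))
                 (∑-comm-*ˡ above cols sign (λ S j → term (A fzero j) j S)) ⟩
  (∑[ j ∈ cols ] (sign j * (∑[ S ∈ below ] term (A fzero j - 1ℤ) j S)))
    + (∑[ j ∈ cols ] (sign j * (∑[ S ∈ above ] term (A fzero j) j S)))
    ≡⟨ sym (∑-+ cols (λ j → sign j * (∑[ S ∈ below ] term (A fzero j - 1ℤ) j S))
                      (λ j → sign j * (∑[ S ∈ above ] term (A fzero j) j S))) ⟩
  ∑[ j ∈ cols ] (sign j * (∑[ S ∈ below ] term (A fzero j - 1ℤ) j S)
                  + sign j * (∑[ S ∈ above ] term (A fzero j) j S))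
    ≡⟨ ∑-cong cols (λ j → trans (sym (ℤ.*-distribˡ-+ (sign j) (∑[ S ∈ below ] term (A fzero j - 1ℤ) j S)
                                                                           (∑[ S ∈ above ] term (A fzero j) j S)))
                                (cong (sign j *_) (pairH-eSkew d (skewIdentity m) (A fzero j) (minor A j) φ))) ⟩
  ∑[ j ∈ cols ] (sign j * pairH (A fzero j) (eSkew (suc d) φ) (hDet (minor A j)))
    ≡⟨ sym (pair-hDet-suc (eSkew (suc d) φ) A) ⟩
  pair (eSkew (suc d) φ) (hDet A)
    ∎
  where
  open ≡-Reasoning
  below = subsetsOfSize m d
  above = subsetsOfSize m (suc d)
  cols = allFin (suc m)

  lowered : List (Fin (suc m)) → ℤ
  lowered S = pair φ (hDet (lowerRows A S))

  term : ℤ → Fin (suc m) → List (Fin m) → ℤ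
  term a j S = pairH a φ (hDet (lowerRows (minor A j) S))

  expand-with-0 : (S : List (Fin m)) →
    lowered (fzero ∷ map fsuc S) ≡ ∑[ j ∈ cols ] (sign j * term (A fzero j - 1ℤ) j S)
  expand-with-0 S = pair-hDet-lowerRows φ A (fzero ∷ map fsuc S) S (indicator-fsuc S)

  expand-without-0 : (S : List (Fin m)) →
    lowered (map fsuc S) ≡ ∑[ j ∈ cols ] (sign j * term (A fzero j) j S)
  expand-without-0 S =
    trans (pair-hDet-lowerRows φ A (map fsuc S) S (indicator-fsuc S))
          (∑-cong cols (λ j → cong (λ a → sign j * term a j S)
            (trans (cong (A fzero j -_) (indicator-fzero S)) (ℤ.+-identityʳ (A fzero j)))))

sub-+-sub-comm : (x c a b : ℤ) → ((x - c) + a) - b ≡ ((x + a) - b) - c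
sub-+-sub-comm = solve 4 (λ x c a b → ((x :- c) :+ a) :- b := ((x :+ a) :- b) :- c) refl
  where open +-*-Solver

jacobiTrudi : {ℓ : ℕ} → (Fin ℓ → ℤ) → Fin ℓ → Fin ℓ → ℤ
jacobiTrudi γ i j = (γ i + + toℕ j) - + toℕ i

s-cong : (ℓ : ℕ) {γ δ : Fin ℓ → ℤ} → γ ≗ δ → s ℓ γ ≡ s ℓ δ
s-cong ℓ γ≗δ = hDet-cong (λ i j → cong (λ x → (x + + toℕ j) - + toℕ i) (γ≗δ i))

s-minusε : (ℓ : ℕ) (γ : Fin ℓ → ℤ) (S : List (Fin ℓ)) →
  s ℓ (minusε γ S) ≡ hDet (lowerRows (jacobiTrudi γ) S)
s-minusε ℓ γ S = hDet-cong (λ i j → sub-+-sub-comm (γ i) (indicator S i) (+ toℕ j) (+ toℕ i))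

∑-pair-s-minusε : (ℓ d : ℕ) (γ : Fin ℓ → ℤ) (φ : List ℕ → ℤ) →
  ∑[ S ∈ subsetsOfSize ℓ d ] pair φ (s ℓ (minusε γ S)) ≡ pair (eSkew d φ) (s ℓ γ)
∑-pair-s-minusε ℓ d γ φ =
  trans (∑-cong (subsetsOfSize ℓ d) (cong (pair φ) ∘ s-minusε ℓ γ))
        (skewIdentity ℓ d (jacobiTrudi γ) φ)

shift-minusε : {ℓ : ℕ} (γ : Fin ℓ → ℤ) (S : List (Fin ℓ)) (rs : List (Fin ℓ × Fin ℓ)) (ms : List ℕ) →
  shift (minusε γ S) rs ms ≗ minusε (shift γ rs ms) S
shift-minusε γ S []       ms       p = refl
shift-minusε γ S (r ∷ rs) []       p = refl
shift-minusε γ S (r ∷ rs) (m ∷ ms) p =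
  trans (cong (λ x → (x + raise) - lower) (shift-minusε γ S rs ms p))
        (sub-+-sub-comm (shift γ rs ms p) (indicator S p) raise lower)
  where
  raise lower : ℤ
  raise = if ⌊ p ≟ proj₁ r ⌋ then + m else 0ℤ
  lower = if ⌊ p ≟ proj₂ r ⌋ then + m else 0ℤ

pair-Hcoeff : (φ : List ℕ → ℤ) (ℓ : ℕ) (Ψ : Fin ℓ → Fin ℓ → Bool) (γ : Fin ℓ → ℤ) (k : ℕ) →
  pair φ (Hcoeff ℓ Ψ γ k)
    ≡ ∑[ ms ∈ comps (length (roots Ψ)) k ] pair φ (s ℓ (shift γ (roots Ψ) ms))
pair-Hcoeff φ ℓ Ψ γ k = pair-sumP-map φ (λ ms → s ℓ (shift γ (roots Ψ) ms)) (comps (length (roots Ψ)) k)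

lemma4p11 : (ℓ d : ℕ) (Ψ : Fin ℓ → Fin ℓ → Bool) → IsRootIdeal Ψ → (γ : Fin ℓ → ℤ) →
    (k : ℕ) (g : Λ) →
    ⟨ sumP (map (λ S → Hcoeff ℓ Ψ (minusε γ S) k) (subsetsOfSize ℓ d)) , g ⟩
      ≡ ⟨ Hcoeff ℓ Ψ γ k , eΛ d *P g ⟩
lemma4p11 ℓ d Ψ _ γ k g = begin
  pair φ (sumP (map (λ S → Hcoeff ℓ Ψ (minusε γ S) k) subsets))
    ≡⟨ pair-sumP-map φ (λ S → Hcoeff ℓ Ψ (minusε γ S) k) subsets ⟩
  ∑[ S ∈ subsets ] pair φ (Hcoeff ℓ Ψ (minusε γ S) k)
    ≡⟨ ∑-cong subsets (λ S → pair-Hcoeff φ ℓ Ψ (minusε γ S) k) ⟩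
  ∑[ S ∈ subsets ] ∑[ ms ∈ cs ] pair φ (s ℓ (shift (minusε γ S) rs ms))
    ≡⟨ ∑-comm subsets cs (λ S ms → pair φ (s ℓ (shift (minusε γ S) rs ms))) ⟩
  ∑[ ms ∈ cs ] ∑[ S ∈ subsets ] pair φ (s ℓ (shift (minusε γ S) rs ms))
    ≡⟨ ∑-cong cs (λ ms →
         trans (∑-cong subsets (λ S → cong (pair φ) (s-cong ℓ (shift-minusε γ S rs ms))))
               (∑-pair-s-minusε ℓ d (shift γ rs ms) φ)) ⟩
  ∑[ ms ∈ cs ] pair (eSkew d φ) (s ℓ (shift γ rs ms))
    ≡⟨ sym (pair-Hcoeff (eSkew d φ) ℓ Ψ γ k) ⟩
  pair (eSkew d φ) (Hcoeff ℓ Ψ γ k)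
    ≡⟨ pair-cong (Hcoeff ℓ Ψ γ k) (sym ∘ mcoeff-eΛ*P d g) ⟩
  pair (mcoeff (eΛ d *P g)) (Hcoeff ℓ Ψ γ k)
    ∎
  where
  open ≡-Reasoning
  φ = mcoeff g
  rs = roots Ψ
  cs = comps (length rs) k
  subsets = subsetsOfSize ℓ d
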